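{- Let $F$ be a bipartite graph with sides $A, B$ and $m$ edges. Let $k, \ell \geq 0$, let $A'$ be a set of the $k$ highest-degree vertices in $A$, and let $B'$ be a set of the $\ell$ highest-degree vertices in $B$ (degrees taken in $F$). Let $G$ be a graph with $N$ vertices and average degree $d$. Let $\sigma' : A' \cup B' \to V(G)$ be an embedding of $F[A' \cup B']$ into $\overline{G}$. Suppose that (1) $B' = B$ or $N \geq \frac{2m}{\ell+1} \cdot \max_{v \in \sigma'(A')} d_G(v) + 2|V(F)|$; and (2) $A' = A$ or $N \geq \frac{m}{k+1} \cdot \max\big( \max_{v \in \sigma'(B')} d_G(v),\; 2d \big) + |V(F)|$. Then there is an embedding $\sigma$ of $F$ into $\overline{G}$ which extends $\sigma'$.
   Context: An embedding of a graph $F$ into $\overline{G}$ (the complement of $G$) is an injective map $V(F) \to V(G)$ sending every edge of $F$ to a pair of vertices that is non-adjacent in $G$. $F[S]$ is the subgraph of $F$ induced on $S$, and $d_G(v)$ is the degree of $v$ in $G$. A set of the $k$ highest-degree vertices of $A$ means a $k$-subset of $A$ such that every vertex in it has degree at least that of every vertex of $A$ outside it. -}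

module Defs where

open import Data.Nat using (ℕ; zero; suc; _+_; _*_; _≤_; _<_; _⊔_)
open import Data.Bool using (Bool; true; false; if_then_else_; _∨_; _∧_)
open import Data.Fin using (Fin; toℕ) renaming (zero to fzero; suc to fsuc)
open import Data.Fin using (_<?_)
open import Relation.Nullary using (¬_)
open import Relation.Nullary.Decidable using (⌊_⌋)
open import Relation.Binary.PropositionalEquality using (_≡_; refl)
open import Data.Product using (_×_)
open import Data.Sum using (_⊎_)

sumFin : {n : ℕ} → (Fin n → ℕ) → ℕ
sumFin {zero} f = 0
sumFin {suc n} f = f fzero + sumFin (λ v → f (fsuc v))

count : {n : ℕ} → (Fin n → Bool) → ℕ
count P = sumFin (λ v → if P v then 1 else 0)

-- maximum of f v over v with S v = true; 0 if there is no such v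
maxOverB : (b : Bool) → (b ≡ true → ℕ) → ℕ
maxOverB true g = g refl
maxOverB false g = 0

maxOver : {n : ℕ} → (S : Fin n → Bool) → ((v : Fin n) → S v ≡ true → ℕ) → ℕ
maxOver {zero} S f = 0
maxOver {suc n} S f = maxOverB (S fzero) (f fzero) ⊔ maxOver (λ v → S (fsuc v)) (λ v → f (fsuc v))

record Graph (n : ℕ) : Set where
  field
    adj    : Fin n → Fin n → Bool
    sym    : ∀ u v → adj u v ≡ adj v u
    irrefl : ∀ v → adj v v ≡ false
open Graph public

deg : {n : ℕ} → Graph n → Fin n → ℕ
deg G v = count (adj G v)

edges : {n : ℕ} → Graph n → ℕ
edges G = sumFin (λ u → count (λ v → adj G u v ∧ ⌊ u <? v ⌋))

-- F is bipartite with sides A = {side = true}, B = {side = false}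
IsBipartition : {n : ℕ} → Graph n → (Fin n → Bool) → Set
IsBipartition F side = ∀ u v → adj F u v ≡ true → ¬ (side u ≡ side v)

IsTopDeg : {n : ℕ} → Graph n → (P T : Fin n → Bool) → ℕ → Set
IsTopDeg F P T k =
  (∀ v → T v ≡ true → P v ≡ true) ×
  (count T ≡ k) ×
  (∀ u v → T u ≡ true → P v ≡ true → T v ≡ false → deg F v ≤ deg F u)

-- set equality T = P given T ⊆ P
Covers : {n : ℕ} → (P T : Fin n → Bool) → Set
Covers P T = ∀ v → P v ≡ true → T v ≡ true

∨-inˡ : (a b : Bool) → a ≡ true → (a ∨ b) ≡ true
∨-inˡ true b refl = refl

∨-inʳ : (a b : Bool) → b ≡ true → (a ∨ b) ≡ true
∨-inʳ true b refl = refl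
∨-inʳ false b p = p

IsPartialEmbedding : {n N : ℕ} → Graph n → Graph N → (S : Fin n → Bool) →
  ((v : Fin n) → S v ≡ true → Fin N) → Set
IsPartialEmbedding F G S σ' =
  (∀ u v (pu : S u ≡ true) (pv : S v ≡ true) → σ' u pu ≡ σ' v pv → u ≡ v) ×
  (∀ u v (pu : S u ≡ true) (pv : S v ≡ true) → adj F u v ≡ true → adj G (σ' u pu) (σ' v pv) ≡ false)

IsEmbedding : {n N : ℕ} → Graph n → Graph N → (Fin n → Fin N) → Set
IsEmbedding F G σ =
  (∀ u v → σ u ≡ σ v → u ≡ v) ×
  (∀ u v → adj F u v ≡ true → adj G (σ u) (σ v) ≡ false)

-- Greedy embedding in two phases.  First the vertices of B ∖ B′ are placed one at a time.  A new
-- vertex v must avoid the fewer than |V(F)| images already used, the G-neighbourhoods of its embedded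
-- neighbours (these lie in σ'(A′), so they cover at most deg v · Δ(A′) ≤ m/(ℓ+1) · Δ(A′) vertices),
-- and the vertices of G of degree above 2d, of which there are at most N/2 by Markov's inequality;
-- condition (1) says that some vertex of G remains.  Every image chosen so far has degree at most
-- max(Δ(B′), 2d), so in the second phase each vertex of A ∖ A′, all of whose neighbours are already
-- embedded, has a free image by condition (2).  The bounds deg v ≤ m/(ℓ+1) and deg v ≤ m/(k+1) hold
-- because v lies outside a top-degree set and the degrees on either side of a bipartite graph sum to m.

module Submission where

open import Defs hiding (sym)
open import Data.Nat using (ℕ; zero; suc; _+_; _*_; _≤_; _<_; _⊔_; z≤n; s≤s)
import Data.Nat as ℕ
open import Data.Nat.Properties hiding (_≟_; _<?_)
import Algebra.Properties.Semiring.Sum as SemiringSum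
open import Data.Bool using (Bool; true; false; if_then_else_; _∨_; _∧_; not)
import Data.Bool.Properties as Boolₚ
open import Data.Fin using (Fin; inject≤; _≟_; _<?_) renaming (zero to fzero; suc to fsuc)
import Data.Fin.Properties as Finₚ
open import Data.Product using (_×_; _,_; Σ; proj₁; proj₂)
open import Data.Sum using (_⊎_; inj₁; inj₂; [_,_]′)
open import Function using (id)
open import Data.Empty using (⊥-elim)
open import Data.List using (List; []; _∷_; allFin)
open import Data.List.Membership.Propositional using (_∈_)
open import Data.List.Membership.Propositional.Properties using (∈-allFin)
open import Data.List.Relation.Unary.Any using (here; there)
open import Relation.Nullary using (¬_; yes; no; Dec)
open import Relation.Nullary.Decidable using (⌊_⌋; does; dec-true; dec-false; isYes≗does)
open import Relation.Binary.PropositionalEquality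
open import Data.Nat.Tactic.RingSolver using (solve)
open import Relation.Binary using (tri<; tri≈; tri>)
open import Axiom.UniquenessOfIdentityProofs using (module Decidable⇒UIP)

private module ∑ = SemiringSum +-*-semiring

false≢true : ¬ false ≡ true
false≢true ()

Bool-irrelevant : ∀ {b c : Bool} (p q : b ≡ c) → p ≡ q
Bool-irrelevant = Decidable⇒UIP.≡-irrelevant Boolₚ._≟_

∨≡false⇒ʳ : ∀ a b → (a ∨ b) ≡ false → b ≡ false
∨≡false⇒ʳ false b eq = eq

∨≡false⇒ˡ : ∀ a b → (a ∨ b) ≡ false → a ≡ false
∨≡false⇒ˡ false b eq = refl

isYes-true : ∀ {a} {A : Set a} (a? : Dec A) → A → ⌊ a? ⌋ ≡ true
isYes-true a? a = trans (isYes≗does a?) (dec-true a? a)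

isYes-false : ∀ {a} {A : Set a} (a? : Dec A) → ¬ A → ⌊ a? ⌋ ≡ false
isYes-false a? ¬a = trans (isYes≗does a?) (dec-false a? ¬a)

isYes≡false⇒¬ : ∀ {a} {A : Set a} (a? : Dec A) → ⌊ a? ⌋ ≡ false → ¬ A
isYes≡false⇒¬ (no ¬a) _ = ¬a

sumFin≡sum : ∀ {n} (f : Fin n → ℕ) → sumFin f ≡ ∑.sum f
sumFin≡sum {zero} f = refl
sumFin≡sum {suc n} f = cong (f fzero +_) (sumFin≡sum (λ v → f (fsuc v)))

sumFin-cong : ∀ {n} {f g : Fin n → ℕ} → (∀ v → f v ≡ g v) → sumFin f ≡ sumFin g
sumFin-cong {f = f} {g} f≗g = trans (sumFin≡sum f) (trans (∑.sum-cong-≗ f≗g) (sym (sumFin≡sum g)))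

sumFin-mono-≤ : ∀ {n} {f g : Fin n → ℕ} → (∀ v → f v ≤ g v) → sumFin f ≤ sumFin g
sumFin-mono-≤ {zero} f≤g = z≤n
sumFin-mono-≤ {suc n} f≤g = +-mono-≤ (f≤g fzero) (sumFin-mono-≤ (λ v → f≤g (fsuc v)))

sumFin-zero : ∀ n → sumFin {n} (λ _ → 0) ≡ 0
sumFin-zero n = trans (sumFin≡sum {n} _) (∑.sum-replicate-zero n)

sumFin-+ : ∀ {n} (f g : Fin n → ℕ) → sumFin (λ v → f v + g v) ≡ sumFin f + sumFin g
sumFin-+ f g = begin
  sumFin (λ v → f v + g v)  ≡⟨ sumFin≡sum (λ v → f v + g v) ⟩
  ∑.sum (λ v → f v + g v)   ≡⟨ ∑.∑-distrib-+ f g ⟩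
  ∑.sum f + ∑.sum g         ≡⟨ sym (cong₂ _+_ (sumFin≡sum f) (sumFin≡sum g)) ⟩
  sumFin f + sumFin g       ∎
  where open ≡-Reasoning

*-distribˡ-sumFin : ∀ {n} c (f : Fin n → ℕ) → c * sumFin f ≡ sumFin (λ v → c * f v)
*-distribˡ-sumFin c f = begin
  c * sumFin f              ≡⟨ cong (c *_) (sumFin≡sum f) ⟩
  c * ∑.sum f               ≡⟨ ∑.*-distribˡ-sum c f ⟩
  ∑.sum (λ v → c * f v)     ≡⟨ sym (sumFin≡sum (λ v → c * f v)) ⟩
  sumFin (λ v → c * f v)    ∎
  where open ≡-Reasoning

sumFin-comm : ∀ {m n} (h : Fin m → Fin n → ℕ) →
  sumFin (λ x → sumFin (h x)) ≡ sumFin (λ u → sumFin (λ x → h x u))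
sumFin-comm h = begin
  sumFin (λ x → sumFin (h x))             ≡⟨ sumFin≡sum (λ x → sumFin (h x)) ⟩
  ∑.sum (λ x → sumFin (h x))              ≡⟨ ∑.sum-cong-≗ (λ x → sumFin≡sum (h x)) ⟩
  ∑.sum (λ x → ∑.sum (h x))               ≡⟨ ∑.∑-comm h ⟩
  ∑.sum (λ u → ∑.sum (λ x → h x u))       ≡⟨ sym (∑.sum-cong-≗ (λ u → sumFin≡sum (λ x → h x u))) ⟩
  ∑.sum (λ u → sumFin (λ x → h x u))      ≡⟨ sym (sumFin≡sum (λ u → sumFin (λ x → h x u))) ⟩
  sumFin (λ u → sumFin (λ x → h x u))     ∎
  where open ≡-Reasoning

sumFin≡0⇒≡0 : ∀ {n} (f : Fin n → ℕ) → sumFin f ≡ 0 → ∀ v → f v ≡ 0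
sumFin≡0⇒≡0 f eq fzero = m+n≡0⇒m≡0 (f fzero) eq
sumFin≡0⇒≡0 f eq (fsuc v) = sumFin≡0⇒≡0 (λ u → f (fsuc u)) (m+n≡0⇒n≡0 (f fzero) eq) v

sumFin<⇒∃≡0 : ∀ {n} (f : Fin n → ℕ) → sumFin f < n → Σ (Fin n) (λ x → f x ≡ 0)
sumFin<⇒∃≡0 {suc n} f Σf<n with f fzero in eq
... | zero = fzero , eq
... | suc a = let x , fx≡0 = sumFin<⇒∃≡0 (λ v → f (fsuc v)) (≤-trans (s≤s (m≤n+m _ a)) (ℕ.s≤s⁻¹ Σf<n))
              in fsuc x , fx≡0

maxOver-≥ : ∀ {n} (P : Fin n → Bool) (f : (v : Fin n) → P v ≡ true → ℕ) v (Pv : P v ≡ true) → f v Pv ≤ maxOver P f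
maxOver-≥ P f fzero Pv = m≤n⇒m≤n⊔o _ (head≤ (P fzero) (f fzero) Pv)
  where
  head≤ : ∀ b (g : b ≡ true → ℕ) (p : b ≡ true) → g p ≤ maxOverB b g
  head≤ true g refl = ≤-refl
maxOver-≥ P f (fsuc v) Pv = m≤n⇒m≤o⊔n (maxOverB (P fzero) (f fzero)) (maxOver-≥ (λ u → P (fsuc u)) (λ u → f (fsuc u)) v Pv)

if-+ : ∀ b x y → (if b then x else 0) + (if b then y else 0) ≡ (if b then x + y else 0)
if-+ true x y = refl
if-+ false x y = refl

sumFin-indicator : ∀ {n} (P : Fin n → Bool) c → sumFin (λ x → if P x then c else 0) ≡ count P * c
sumFin-indicator P c = begin
  sumFin (λ x → if P x then c else 0)     ≡⟨ sumFin-cong indicator ⟩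
  sumFin (λ x → c * (if P x then 1 else 0)) ≡⟨ sym (*-distribˡ-sumFin c (λ x → if P x then 1 else 0)) ⟩
  c * count P                              ≡⟨ *-comm c (count P) ⟩
  count P * c                              ∎
  where
  open ≡-Reasoning
  indicator : ∀ x → (if P x then c else 0) ≡ c * (if P x then 1 else 0)
  indicator x with P x
  ... | true = sym (*-identityʳ c)
  ... | false = sym (*-zeroʳ c)

count≤n : ∀ {n} (P : Fin n → Bool) → count P ≤ n
count≤n {zero} P = z≤n
count≤n {suc n} P with P fzero
... | true = s≤s (count≤n (λ v → P (fsuc v)))
... | false = m≤n⇒m≤1+n (count≤n (λ v → P (fsuc v)))

count<n : ∀ {n} (P : Fin n → Bool) v → P v ≡ false → count P < n
count<n P fzero Pv≡false rewrite Pv≡false = s≤s (count≤n (λ v → P (fsuc v)))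
count<n P (fsuc v) Pv≡false with P fzero
... | true = s≤s (count<n (λ u → P (fsuc u)) v Pv≡false)
... | false = m≤n⇒m≤1+n (count<n (λ u → P (fsuc u)) v Pv≡false)

count≡0⇒≡false : ∀ {n} (P : Fin n → Bool) → count P ≡ 0 → ∀ x → P x ≡ false
count≡0⇒≡false P eq x with P x | sumFin≡0⇒≡0 _ eq x
... | false | _ = refl

count-≟ : ∀ {n} (y : Fin n) → count (λ x → does (y ≟ x)) ≡ 1
count-≟ {suc n} fzero = cong suc (sumFin-zero n)
count-≟ (fsuc y) = count-≟ y

count-∧ˡ : ∀ {n} b (P : Fin n → Bool) → count (λ x → b ∧ P x) ≡ (if b then count P else 0)
count-∧ˡ true P = refl
count-∧ˡ {n} false P = sumFin-zero n

sumFin-count-comm : ∀ {m n} (P : Fin m → Bool) (R : Fin m → Fin n → Bool) →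
  sumFin (λ x → count (λ u → P u ∧ R u x)) ≡ sumFin (λ u → if P u then count (R u) else 0)
sumFin-count-comm P R =
  trans (sumFin-comm (λ x u → if P u ∧ R u x then 1 else 0)) (sumFin-cong (λ u → count-∧ˡ (P u) (R u)))

count-markov : ∀ {n} a (w : Fin n → ℕ) → count (λ x → ⌊ a ℕ.<? w x ⌋) * suc a ≤ sumFin w
count-markov a w = begin
  count (λ x → ⌊ a ℕ.<? w x ⌋) * suc a              ≡⟨ sym (sumFin-indicator (λ x → ⌊ a ℕ.<? w x ⌋) (suc a)) ⟩
  sumFin (λ x → if ⌊ a ℕ.<? w x ⌋ then suc a else 0) ≤⟨ sumFin-mono-≤ above ⟩
  sumFin w                                           ∎
  where
  open ≤-Reasoning
  above : ∀ x → (if ⌊ a ℕ.<? w x ⌋ then suc a else 0) ≤ w x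
  above x with a ℕ.<? w x
  ... | yes a<wx = a<wx
  ... | no _ = z≤n

module _ {n} (G : Graph n) where

  -- Each edge uv with u < v is met once from u and once from v.
  weighted-handshake : (w : Fin n → ℕ) →
    sumFin (λ u → w u * deg G u) ≡
    sumFin (λ u → sumFin (λ v → if adj G u v ∧ ⌊ u <? v ⌋ then w u + w v else 0))
  weighted-handshake w = begin
    sumFin (λ u → w u * deg G u)                 ≡⟨ sumFin-cong (λ u → *-distribˡ-sumFin (w u) (λ v → if adj G u v then 1 else 0)) ⟩
    sumFin (λ u → sumFin (λ v → w u * (if adj G u v then 1 else 0)))
                                                 ≡⟨ sumFin-cong (λ u → sumFin-cong (λ v → weight-split u v)) ⟩
    sumFin (λ u → sumFin (λ v → forward u v + backward u v))
                                                 ≡⟨ sumFin-cong (λ u → sumFin-+ (forward u) (backward u)) ⟩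
    sumFin (λ u → sumFin (forward u) + sumFin (backward u))
                                                 ≡⟨ sumFin-+ (λ u → sumFin (forward u)) (λ u → sumFin (backward u)) ⟩
    sumFin (λ u → sumFin (forward u)) + sumFin (λ u → sumFin (backward u))
                                                 ≡⟨ cong (sumFin (λ u → sumFin (forward u)) +_) backward-reindex ⟩
    sumFin (λ u → sumFin (forward u)) + sumFin (λ u → sumFin (forward′ u))
                                                 ≡⟨ sym (sumFin-+ (λ u → sumFin (forward u)) (λ u → sumFin (forward′ u))) ⟩
    sumFin (λ u → sumFin (forward u) + sumFin (forward′ u))
                                                 ≡⟨ sumFin-cong (λ u → sym (sumFin-+ (forward u) (forward′ u))) ⟩
    sumFin (λ u → sumFin (λ v → forward u v + forward′ u v))
                                                 ≡⟨ sumFin-cong (λ u → sumFin-cong (λ v → if-+ (adj G u v ∧ ⌊ u <? v ⌋) (w u) (w v))) ⟩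
    sumFin (λ u → sumFin (λ v → if adj G u v ∧ ⌊ u <? v ⌋ then w u + w v else 0)) ∎
    where
    open ≡-Reasoning
    forward backward forward′ : Fin n → Fin n → ℕ
    forward u v = if adj G u v ∧ ⌊ u <? v ⌋ then w u else 0
    backward u v = if adj G u v ∧ ⌊ v <? u ⌋ then w u else 0
    forward′ u v = if adj G u v ∧ ⌊ u <? v ⌋ then w v else 0

    weight-split : ∀ u v → w u * (if adj G u v then 1 else 0) ≡ forward u v + backward u v
    weight-split u v with Finₚ.<-cmp u v
    ... | tri< u<v _ v≮u rewrite isYes-true (u <? v) u<v | isYes-false (v <? u) v≮u
                                | Boolₚ.∧-identityʳ (adj G u v) | Boolₚ.∧-zeroʳ (adj G u v) with adj G u v
    ...   | true = trans (*-identityʳ (w u)) (sym (+-identityʳ (w u)))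
    ...   | false = *-zeroʳ (w u)
    weight-split u v | tri≈ _ refl _ rewrite irrefl G u = *-zeroʳ (w u)
    weight-split u v | tri> u≮v _ v<u rewrite isYes-false (u <? v) u≮v | isYes-true (v <? u) v<u
                                | Boolₚ.∧-identityʳ (adj G u v) | Boolₚ.∧-zeroʳ (adj G u v) with adj G u v
    ...   | true = *-identityʳ (w u)
    ...   | false = *-zeroʳ (w u)

    backward-reindex : sumFin (λ u → sumFin (backward u)) ≡ sumFin (λ u → sumFin (forward′ u))
    backward-reindex = trans (sumFin-comm backward)
      (sumFin-cong (λ v → sumFin-cong (λ u → cong (λ b → if b ∧ ⌊ v <? u ⌋ then w u else 0) (Graph.sym G u v))))

  sum-deg≡2*edges : sumFin (deg G) ≡ 2 * edges G
  sum-deg≡2*edges = begin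
    sumFin (deg G)                                         ≡⟨ sumFin-cong (λ u → sym (*-identityˡ (deg G u))) ⟩
    sumFin (λ u → 1 * deg G u)                             ≡⟨ weighted-handshake (λ _ → 1) ⟩
    sumFin (λ u → sumFin (λ v → if forward u v then 2 else 0))
                                                           ≡⟨ sumFin-cong (λ u → sumFin-indicator (forward u) 2) ⟩
    sumFin (λ u → count (forward u) * 2)                   ≡⟨ sumFin-cong (λ u → *-comm (count (forward u)) 2) ⟩
    sumFin (λ u → 2 * count (forward u))                   ≡⟨ sym (*-distribˡ-sumFin 2 (λ u → count (forward u))) ⟩
    2 * edges G                                            ∎
    where
    open ≡-Reasoning
    forward : Fin n → Fin n → Bool
    forward u v = adj G u v ∧ ⌊ u <? v ⌋

IsBipartition-not : ∀ {n} (F : Graph n) (side : Fin n → Bool) →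
  IsBipartition F side → IsBipartition F (λ v → not (side v))
IsBipartition-not F side bip u v uv∈F eq = bip u v uv∈F (Boolₚ.not-injective eq)

sum-deg-side≡edges : ∀ {n} (F : Graph n) (P : Fin n → Bool) → IsBipartition F P →
  sumFin (λ u → if P u then deg F u else 0) ≡ edges F
sum-deg-side≡edges F P bip = begin
  sumFin (λ u → if P u then deg F u else 0)   ≡⟨ sumFin-cong (λ u → sym (indicator-* (P u) (deg F u))) ⟩
  sumFin (λ u → w u * deg F u)                ≡⟨ weighted-handshake F w ⟩
  sumFin (λ u → sumFin (λ v → if adj F u v ∧ ⌊ u <? v ⌋ then w u + w v else 0))
                                              ≡⟨ sumFin-cong (λ u → sumFin-cong (λ v → one-endpoint-in-P u v)) ⟩
  edges F                                     ∎
  where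
  open ≡-Reasoning
  w : _ → ℕ
  w u = if P u then 1 else 0
  indicator-* : ∀ b x → (if b then 1 else 0) * x ≡ (if b then x else 0)
  indicator-* true x = +-identityʳ x
  indicator-* false x = refl
  one-endpoint-in-P : ∀ u v →
    (if adj F u v ∧ ⌊ u <? v ⌋ then w u + w v else 0) ≡ (if adj F u v ∧ ⌊ u <? v ⌋ then 1 else 0)
  one-endpoint-in-P u v with adj F u v in uv∈F
  ... | false = refl
  ... | true with P u | P v | bip u v uv∈F
  ...   | true  | true  | Pu≢Pv = ⊥-elim (Pu≢Pv refl)
  ...   | true  | false | _ = refl
  ...   | false | true  | _ = refl
  ...   | false | false | Pu≢Pv = ⊥-elim (Pu≢Pv refl)

-- The k vertices of T together with v itself each have degree at least deg v.
IsTopDeg⇒deg-bound : ∀ {n} (F : Graph n) (P T : Fin n → Bool) k → IsTopDeg F P T k →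
  ∀ v → P v ≡ true → T v ≡ false → suc k * deg F v ≤ sumFin (λ u → if P u then deg F u else 0)
IsTopDeg⇒deg-bound F P T k (T⊆P , |T|≡k , T-top) v Pv Tv = begin
  suc k * d                                       ≡⟨ cong (_* d) (+-comm 1 k) ⟩
  (k + 1) * d                                     ≡⟨ cong (_* d) (cong₂ _+_ (sym |T|≡k) (sym (count-≟ v))) ⟩
  (count T + count (λ u → does (v ≟ u))) * d      ≡⟨ *-distribʳ-+ d (count T) _ ⟩
  count T * d + count (λ u → does (v ≟ u)) * d    ≡⟨ sym (cong₂ _+_ (sumFin-indicator T d) (sumFin-indicator (λ u → does (v ≟ u)) d)) ⟩
  sumFin (λ u → if T u then d else 0) + sumFin (λ u → if does (v ≟ u) then d else 0)
                                                  ≡⟨ sym (sumFin-+ (λ u → if T u then d else 0) (λ u → if does (v ≟ u) then d else 0)) ⟩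
  sumFin (λ u → (if T u then d else 0) + (if does (v ≟ u) then d else 0))
                                                  ≤⟨ sumFin-mono-≤ dominated ⟩
  sumFin (λ u → if P u then deg F u else 0)       ∎
  where
  open ≤-Reasoning
  d : ℕ
  d = deg F v
  dominated : ∀ u → (if T u then d else 0) + (if does (v ≟ u) then d else 0) ≤ (if P u then deg F u else 0)
  dominated u with v ≟ u
  ... | yes refl rewrite Tv | Pv = ≤-refl
  ... | no _ with T u in Tu
  ...   | false = z≤n
  ...   | true rewrite T⊆P u Tu = ≤-trans (≤-reflexive (+-identityʳ d)) (T-top u v Tu Pv Tv)

Covers⇒≡false : ∀ {n} (P D : Fin n → Bool) → Covers P D → ∀ v → D v ≡ false → P v ≡ false
Covers⇒≡false P D P⊆D v Dv with P v in Pv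
... | false = refl
... | true = ⊥-elim (false≢true (trans (sym Dv) (P⊆D v Pv)))

covers-both-sides : ∀ {n} (side D₁ D₂ : Fin n → Bool) →
  Covers (λ v → not (side v)) D₁ → Covers D₁ D₂ → Covers side D₂ → ∀ v → D₂ v ≡ true
covers-both-sides side D₁ D₂ B⊆D₁ D₁⊆D₂ A⊆D₂ v with side v in sv
... | true = A⊆D₂ v sv
... | false = D₁⊆D₂ v (B⊆D₁ v (cong not sv))

insert : ∀ {n} → (Fin n → Bool) → Fin n → Fin n → Bool
insert D v u = D u ∨ does (u ≟ v)

update : ∀ {n} {X : Set} → (Fin n → X) → Fin n → X → Fin n → X
update τ v x u = if does (u ≟ v) then x else τ u

insert-⊇ : ∀ {n} (D : Fin n → Bool) v → Covers D (insert D v)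
insert-⊇ D v u Du rewrite Du = refl

insert-new : ∀ {n} (D : Fin n → Bool) v → insert D v v ≡ true
insert-new D v rewrite dec-true (v ≟ v) refl = Boolₚ.∨-zeroʳ (D v)

update-≢ : ∀ {n} {X : Set} (τ : Fin n → X) v x u → ¬ u ≡ v → update τ v x u ≡ τ u
update-≢ τ v x u u≢v rewrite dec-false (u ≟ v) u≢v = refl

update-view : ∀ {n} {X : Set} (D : Fin n → Bool) (τ : Fin n → X) v x u → insert D v u ≡ true →
  (u ≡ v × update τ v x u ≡ x) ⊎ (D u ≡ true × update τ v x u ≡ τ u)
update-view D τ v x u u∈D+v with u ≟ v
... | yes u≡v = inj₁ (u≡v , refl)
... | no _ = inj₂ (trans (sym (Boolₚ.∨-identityʳ (D u))) u∈D+v , refl)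

module _ {n N : ℕ} (F : Graph n) (G : Graph N) where

  Embeds : (Fin n → Bool) → (Fin n → Fin N) → Set
  Embeds D τ = IsPartialEmbedding F G D (λ u _ → τ u)

  IsPartialEmbedding-cong : ∀ {D} {σ : (v : Fin n) → D v ≡ true → Fin N}
    (τ : Fin n → Fin N) → (∀ u p → τ u ≡ σ u p) → IsPartialEmbedding F G D σ → Embeds D τ
  IsPartialEmbedding-cong τ τ≡σ (σ-inj , σ-edges) =
    (λ u w pu pw τu≡τw → σ-inj u w pu pw (trans (sym (τ≡σ u pu)) (trans τu≡τw (τ≡σ w pw)))) ,
    (λ u w pu pw uw∈F → subst₂ (λ a b → adj G a b ≡ false) (sym (τ≡σ u pu)) (sym (τ≡σ w pw)) (σ-edges u w pu pw uw∈F))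

  Embeds-total : ∀ {D τ} → (∀ v → D v ≡ true) → Embeds D τ → IsEmbedding F G τ
  Embeds-total all (τ-inj , τ-edges) = (λ u w → τ-inj u w (all u) (all w)) , (λ u w → τ-edges u w (all u) (all w))

  Embeds-update : ∀ {D τ} v x → Embeds D τ →
    (∀ u → D u ≡ true → ¬ τ u ≡ x) →
    (∀ u → D u ≡ true → adj F v u ≡ true → adj G (τ u) x ≡ false) →
    Embeds (insert D v) (update τ v x)
  Embeds-update {D} {τ} v x (τ-inj , τ-edges) x-fresh x-nonadj = injective , edges-to-non-edges
    where
    injective : ∀ u w → insert D v u ≡ true → insert D v w ≡ true → update τ v x u ≡ update τ v x w → u ≡ w
    injective u w u∈ w∈ eq with update-view D τ v x u u∈ | update-view D τ v x w w∈
    ... | inj₁ (refl , _) | inj₁ (refl , _) = refl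
    ... | inj₁ (_ , τ′u≡x) | inj₂ (Dw , τ′w≡τw) = ⊥-elim (x-fresh w Dw (trans (sym τ′w≡τw) (trans (sym eq) τ′u≡x)))
    ... | inj₂ (Du , τ′u≡τu) | inj₁ (_ , τ′w≡x) = ⊥-elim (x-fresh u Du (trans (sym τ′u≡τu) (trans eq τ′w≡x)))
    ... | inj₂ (Du , τ′u≡τu) | inj₂ (Dw , τ′w≡τw) = τ-inj u w Du Dw (trans (sym τ′u≡τu) (trans eq τ′w≡τw))

    edges-to-non-edges : ∀ u w → insert D v u ≡ true → insert D v w ≡ true → adj F u w ≡ true →
      adj G (update τ v x u) (update τ v x w) ≡ false
    edges-to-non-edges u w u∈ w∈ uw∈F with update-view D τ v x u u∈ | update-view D τ v x w w∈
    ... | inj₁ (refl , _) | inj₁ (refl , _) = ⊥-elim (false≢true (trans (sym (irrefl F u)) uw∈F))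
    ... | inj₁ (refl , τ′u≡x) | inj₂ (Dw , τ′w≡τw) rewrite τ′u≡x | τ′w≡τw =
          trans (Graph.sym G x (τ w)) (x-nonadj w Dw uw∈F)
    ... | inj₂ (Du , τ′u≡τu) | inj₁ (refl , τ′w≡x) rewrite τ′u≡τu | τ′w≡x =
          x-nonadj u Du (trans (Graph.sym F w u) uw∈F)
    ... | inj₂ (Du , τ′u≡τu) | inj₂ (Dw , τ′w≡τw) rewrite τ′u≡τu | τ′w≡τw = τ-edges u w Du Dw uw∈F

  load : (Fin n → Bool) → (Fin n → Fin N) → Fin n → ℕ
  load D τ v = sumFin (λ u → if D u ∧ adj F v u then deg G (τ u) else 0)

  load-bound : ∀ D τ v c M → (∀ u → D u ≡ true → adj F v u ≡ true → c * deg G (τ u) ≤ M) →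
    c * load D τ v ≤ deg F v * M
  load-bound D τ v c M bounded = begin
    c * load D τ v                                                    ≡⟨ *-distribˡ-sumFin c (λ u → if D u ∧ adj F v u then deg G (τ u) else 0) ⟩
    sumFin (λ u → c * (if D u ∧ adj F v u then deg G (τ u) else 0))   ≤⟨ sumFin-mono-≤ termwise ⟩
    sumFin (λ u → if adj F v u then M else 0)                         ≡⟨ sumFin-indicator (adj F v) M ⟩
    deg F v * M                                                       ∎
    where
    open ≤-Reasoning
    termwise : ∀ u → c * (if D u ∧ adj F v u then deg G (τ u) else 0) ≤ (if adj F v u then M else 0)
    termwise u with D u in Du | adj F v u in uv∈F
    ... | false | _ = ≤-trans (≤-reflexive (*-zeroʳ c)) z≤n
    ... | true | false = ≤-reflexive (*-zeroʳ c)
    ... | true | true = bounded u Du uv∈F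

  used : (Fin n → Bool) → (Fin n → Fin N) → Fin N → ℕ
  used D τ x = count (λ u → D u ∧ does (τ u ≟ x))

  clashes : (Fin n → Bool) → (Fin n → Fin N) → Fin n → Fin N → ℕ
  clashes D τ v x = count (λ u → (D u ∧ adj F v u) ∧ adj G (τ u) x)

  obstruction : (Fin n → Bool) → (Fin n → Fin N) → Fin n → (Fin N → Bool) → Fin N → ℕ
  obstruction D τ v H x = used D τ x + clashes D τ v x + (if H x then 1 else 0)

  sum-obstruction : ∀ D τ v H → sumFin (obstruction D τ v H) ≡ count D + load D τ v + count H
  sum-obstruction D τ v H = begin
    sumFin (obstruction D τ v H)
      ≡⟨ sumFin-+ (λ x → used D τ x + clashes D τ v x) (λ x → if H x then 1 else 0) ⟩
    sumFin (λ x → used D τ x + clashes D τ v x) + count H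
      ≡⟨ cong (_+ count H) (sumFin-+ (used D τ) (clashes D τ v)) ⟩
    sumFin (used D τ) + sumFin (clashes D τ v) + count H
      ≡⟨ cong (λ s → s + sumFin (clashes D τ v) + count H) (sumFin-count-comm D (λ u x → does (τ u ≟ x))) ⟩
    sumFin (λ u → if D u then count (λ x → does (τ u ≟ x)) else 0) + sumFin (clashes D τ v) + count H
      ≡⟨ cong (λ s → s + sumFin (clashes D τ v) + count H) (sumFin-cong (λ u → cong (λ c → if D u then c else 0) (count-≟ (τ u)))) ⟩
    count D + sumFin (clashes D τ v) + count H
      ≡⟨ cong (λ s → count D + s + count H) (sumFin-count-comm (λ u → D u ∧ adj F v u) (λ u → adj G (τ u))) ⟩
    count D + load D τ v + count H
      ∎
    where
    open ≡-Reasoning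

  extension : ∀ {D τ} v (H : Fin N → Bool) → Embeds D τ → count D + load D τ v + count H < N →
    Σ (Fin N) λ x → H x ≡ false × Embeds (insert D v) (update τ v x)
  extension {D} {τ} v H τ-embeds room
    with sumFin<⇒∃≡0 (obstruction D τ v H) (subst (_< N) (sym (sum-obstruction D τ v H)) room)
  ... | x , no-obstruction = x , not-in-H , Embeds-update v x τ-embeds fresh non-adjacent
    where
    unused+unclashed : used D τ x + clashes D τ v x ≡ 0
    unused+unclashed = m+n≡0⇒m≡0 (used D τ x + clashes D τ v x) no-obstruction
    not-in-H : H x ≡ false
    not-in-H with H x | m+n≡0⇒n≡0 (used D τ x + clashes D τ v x) no-obstruction
    ... | false | _ = refl
    fresh : ∀ u → D u ≡ true → ¬ τ u ≡ x
    fresh u Du τu≡x = false≢true (trans (sym unused-by-u) (cong₂ _∧_ Du (dec-true (τ u ≟ x) τu≡x)))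
      where
      unused-by-u : (D u ∧ does (τ u ≟ x)) ≡ false
      unused-by-u = count≡0⇒≡false (λ u → D u ∧ does (τ u ≟ x)) (m+n≡0⇒m≡0 (used D τ x) unused+unclashed) u
    non-adjacent : ∀ u → D u ≡ true → adj F v u ≡ true → adj G (τ u) x ≡ false
    non-adjacent u Du uv∈F = trans (sym (cong₂ (λ a b → (a ∧ b) ∧ adj G (τ u) x) Du uv∈F)) no-clash-at-u
      where
      no-clash-at-u : ((D u ∧ adj F v u) ∧ adj G (τ u) x) ≡ false
      no-clash-at-u =
        count≡0⇒≡false (λ u → (D u ∧ adj F v u) ∧ adj G (τ u) x) (m+n≡0⇒n≡0 (used D τ x) unused+unclashed) u

module Greedy {n} {X : Set} (Inv : (Fin n → Bool) → X → Set) (P : Fin n → Bool)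
  (step : ∀ D x v → Inv D x → D v ≡ false → P v ≡ true → Σ X (Inv (insert D v))) where

  Grown : (Fin n → Bool) → (Fin n → Set) → Set
  Grown D target = Σ (Fin n → Bool) λ D′ → Σ X λ x′ →
    Inv D′ x′ × Covers D D′ × (∀ v → target v → P v ≡ true → D′ v ≡ true)

  grow : (vs : List (Fin n)) → ∀ D x → Inv D x → Grown D (_∈ vs)
  grow [] D x I = D , x , I , (λ _ Du → Du) , (λ _ ())
  grow (v ∷ vs) D x I with D v in Dv | P v in Pv
  ... | true | _ = let D′ , x′ , I′ , D⊆D′ , vs⊆D′ = grow vs D x I in
        D′ , x′ , I′ , D⊆D′ , λ { _ (here refl) _ → D⊆D′ v Dv ; w (there w∈vs) Pw → vs⊆D′ w w∈vs Pw }
  ... | false | false = let D′ , x′ , I′ , D⊆D′ , vs⊆D′ = grow vs D x I in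
        D′ , x′ , I′ , D⊆D′ , λ { _ (here refl) Pv′ → ⊥-elim (false≢true (trans (sym Pv) Pv′))
                                ; w (there w∈vs) Pw → vs⊆D′ w w∈vs Pw }
  ... | false | true = let x₁ , I₁ = step D x v I Dv Pv
                           D′ , x′ , I′ , D+v⊆D′ , vs⊆D′ = grow vs (insert D v) x₁ I₁ in
        D′ , x′ , I′ , (λ u Du → D+v⊆D′ u (insert-⊇ D v u Du)) ,
        λ { _ (here refl) _ → D+v⊆D′ v (insert-new D v) ; w (there w∈vs) Pw → vs⊆D′ w w∈vs Pw }

  grow-all : ∀ D x → Inv D x → Σ (Fin n → Bool) λ D′ → Σ X λ x′ → Inv D′ x′ × Covers D D′ × Covers P D′
  grow-all D x I = let D′ , x′ , I′ , D⊆D′ , all⊆D′ = grow (allFin n) D x I in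
    D′ , x′ , I′ , D⊆D′ , λ v Pv → all⊆D′ v (∈-allFin v) Pv

markov-half : ∀ h e N → h * suc (4 * e) ≤ N * (2 * e) → 2 * h ≤ N
markov-half zero e N _ = z≤n
markov-half (suc h) zero N le with () ← ≤-trans le (≤-reflexive (*-zeroʳ N))
markov-half (suc h) (suc e) N le = *-cancelˡ-≤ (2 * suc e) (begin
  2 * suc e * (2 * suc h)  ≡⟨ solve (e ∷ h ∷ []) ⟩
  suc h * (4 * suc e)      ≤⟨ *-monoʳ-≤ (suc h) (n≤1+n (4 * suc e)) ⟩
  suc h * suc (4 * suc e)  ≤⟨ le ⟩
  N * (2 * suc e)          ≡⟨ *-comm N (2 * suc e) ⟩
  2 * suc e * N            ∎)
  where open ≤-Reasoning

*-⊔-+-lub : ∀ m a b c r → m * a + c ≤ r → m * b + c ≤ r → m * (a ⊔ b) + c ≤ r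
*-⊔-+-lub m a b c r ma+c≤r mb+c≤r = begin
  m * (a ⊔ b) + c          ≡⟨ cong (_+ c) (*-distribˡ-⊔ m a b) ⟩
  (m * a ⊔ m * b) + c      ≡⟨ +-distribʳ-⊔ c (m * a) (m * b) ⟩
  (m * a + c) ⊔ (m * b + c) ≤⟨ ⊔-lub ma+c≤r mb+c≤r ⟩
  r                        ∎
  where open ≤-Reasoning

scaled-bound : ∀ b a x d M m → a * x ≤ d * M → b * d ≤ m → b * (a * x) ≤ m * M
scaled-bound b a x d M m ax≤dM bd≤m = begin
  b * (a * x)  ≤⟨ *-monoʳ-≤ b ax≤dM ⟩
  b * (d * M)  ≡⟨ sym (*-assoc b d M) ⟩
  b * d * M    ≤⟨ *-monoˡ-≤ M bd≤m ⟩
  m * M        ∎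
  where open ≤-Reasoning

scale-condition : ∀ m a c r N → m * a + c ≤ r → m * (N * a) + c * N ≤ r * N
scale-condition m a c r N ma+c≤r = begin
  m * (N * a) + c * N  ≡⟨ solve (m ∷ N ∷ a ∷ c ∷ []) ⟩
  (m * a + c) * N      ≤⟨ *-monoˡ-≤ N ma+c≤r ⟩
  r * N                ∎
  where open ≤-Reasoning

room-phase₁ : ∀ ℓ c L h m M n N → c < n → suc ℓ * L ≤ m * M → 2 * h ≤ N →
  2 * m * M + suc ℓ * (2 * n) ≤ suc ℓ * N → c + L + h < N
room-phase₁ ℓ c L h m M n N c<n ℓL≤mM 2h≤N cond = *-cancelˡ-≤ (2 * suc ℓ) (begin
  2 * suc ℓ * suc (c + L + h)                             ≡⟨ solve (ℓ ∷ c ∷ L ∷ h ∷ []) ⟩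
  suc ℓ * (2 * suc c) + 2 * (suc ℓ * L) + suc ℓ * (2 * h)
    ≤⟨ +-mono-≤ (+-mono-≤ (*-monoʳ-≤ (suc ℓ) (*-monoʳ-≤ 2 c<n)) (*-monoʳ-≤ 2 ℓL≤mM)) (*-monoʳ-≤ (suc ℓ) 2h≤N) ⟩
  suc ℓ * (2 * n) + 2 * (m * M) + suc ℓ * N               ≡⟨ solve (ℓ ∷ n ∷ m ∷ M ∷ N ∷ []) ⟩
  2 * m * M + suc ℓ * (2 * n) + suc ℓ * N                 ≤⟨ +-monoˡ-≤ (suc ℓ * N) cond ⟩
  suc ℓ * N + suc ℓ * N                                   ≡⟨ solve (ℓ ∷ N ∷ []) ⟩
  2 * suc ℓ * N                                           ∎)
  where open ≤-Reasoning

room-phase₂ : ∀ k c L m K n N → c < n → n ≤ N → suc k * (N * L) ≤ m * K →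
  m * K + suc k * n * N ≤ suc k * N * N → c + L < N
room-phase₂ k c L m K (suc n) (suc N) c<n _ kNL≤mK cond = *-cancelˡ-≤ (suc k * suc N) (begin
  suc k * suc N * suc (c + L)                  ≡⟨ solve (k ∷ N ∷ c ∷ L ∷ []) ⟩
  suc k * suc N * suc c + suc k * (suc N * L)  ≤⟨ +-mono-≤ (*-monoʳ-≤ (suc k * suc N) c<n) kNL≤mK ⟩
  suc k * suc N * suc n + m * K                ≡⟨ solve (k ∷ N ∷ n ∷ m ∷ K ∷ []) ⟩
  m * K + suc k * suc n * suc N                ≤⟨ cond ⟩
  suc k * suc N * suc N                        ∎)
  where open ≤-Reasoning

module TwoPhaseEmbedding {n N : ℕ} (F : Graph n) (G : Graph N) (side : Fin n → Bool) (bip : IsBipartition F side)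
  (k ℓ : ℕ) (inA' inB' : Fin n → Bool)
  (A′-top : IsTopDeg F side inA' k) (B′-top : IsTopDeg F (λ v → not (side v)) inB' ℓ)
  (σ' : (v : Fin n) → (inA' v ∨ inB' v) ≡ true → Fin N)
  (σ'-embeds : IsPartialEmbedding F G (λ v → inA' v ∨ inB' v) σ')
  (cond₁ : Covers (λ v → not (side v)) inB' ⊎
      (2 * edges F * maxOver inA' (λ v p → deg G (σ' v (∨-inˡ (inA' v) (inB' v) p)))
        + suc ℓ * (2 * n) ≤ suc ℓ * N))
  (cond₂ : Covers side inA' ⊎
      ((edges F * maxOver inB' (λ v p → deg G (σ' v (∨-inʳ (inA' v) (inB' v) p)))
          + suc k * n ≤ suc k * N) ×
       (edges F * (4 * edges G) + suc k * n * N ≤ suc k * N * N))) where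

  A B S : Fin n → Bool
  A = side
  B v = not (side v)
  S v = inA' v ∨ inB' v

  m e Δ-A′ Δ-B′ K : ℕ
  m = edges F
  e = edges G
  Δ-A′ = maxOver inA' (λ v p → deg G (σ' v (∨-inˡ (inA' v) (inB' v) p)))
  Δ-B′ = maxOver inB' (λ v p → deg G (σ' v (∨-inʳ (inA' v) (inB' v) p)))
  K = N * Δ-B′ ⊔ 4 * e

  -- With d = 2e/N the average degree of G: high x says deg x > 2d, and N * deg ≤ K says deg ≤ max(Δ-B′, 2d).
  high : Fin N → Bool
  high x = ⌊ 4 * e ℕ.<? N * deg G x ⌋

  few-high : 2 * count high ≤ N
  few-high = markov-half (count high) e N (begin
    count high * suc (4 * e)    ≤⟨ count-markov (4 * e) (λ x → N * deg G x) ⟩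
    sumFin (λ x → N * deg G x)  ≡⟨ sym (*-distribˡ-sumFin N (deg G)) ⟩
    N * sumFin (deg G)          ≡⟨ cong (N *_) (sum-deg≡2*edges G) ⟩
    N * (2 * e)                 ∎)
    where open ≤-Reasoning

  deg-A-bound : ∀ v → A v ≡ true → inA' v ≡ false → suc k * deg F v ≤ m
  deg-A-bound v Av A′v = ≤-trans (IsTopDeg⇒deg-bound F A inA' k A′-top v Av A′v)
                                 (≤-reflexive (sum-deg-side≡edges F A bip))

  deg-B-bound : ∀ v → B v ≡ true → inB' v ≡ false → suc ℓ * deg F v ≤ m
  deg-B-bound v Bv B′v = ≤-trans (IsTopDeg⇒deg-bound F B inB' ℓ B′-top v Bv B′v)
                                 (≤-reflexive (sum-deg-side≡edges F B (IsBipartition-not F side bip)))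

  cond₁-at : ∀ v → B v ≡ true → S v ≡ false → 2 * m * Δ-A′ + suc ℓ * (2 * n) ≤ suc ℓ * N
  cond₁-at v Bv Sv =
    [ (λ B⊆B′ → ⊥-elim (false≢true (trans (sym (∨≡false⇒ʳ (inA' v) (inB' v) Sv)) (B⊆B′ v Bv)))) , id ]′ cond₁

  cond₂-at : ∀ v → A v ≡ true → S v ≡ false →
    (m * Δ-B′ + suc k * n ≤ suc k * N) × (m * (4 * e) + suc k * n * N ≤ suc k * N * N)
  cond₂-at v Av Sv =
    [ (λ A⊆A′ → ⊥-elim (false≢true (trans (sym (∨≡false⇒ˡ (inA' v) (inB' v) Sv)) (A⊆A′ v Av)))) , id ]′ cond₂

  n≤N : ∀ v → S v ≡ false → n ≤ N
  n≤N v Sv with side v in sv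
  ... | true = *-cancelˡ-≤ (suc k) (≤-trans (m≤n+m (suc k * n) (m * Δ-B′)) (proj₁ (cond₂-at v sv Sv)))
  ... | false = ≤-trans (m≤m+n n (n + 0))
                  (*-cancelˡ-≤ (suc ℓ) (≤-trans (m≤n+m _ (2 * m * Δ-A′)) (cond₁-at v (cong not sv) Sv)))

  side-of-neighbour : ∀ u v → adj F v u ≡ true → side u ≡ not (side v)
  side-of-neighbour u v vu∈F with side u | side v | bip v u vu∈F
  ... | true  | true  | ≢ = ⊥-elim (≢ refl)
  ... | true  | false | _ = refl
  ... | false | true  | _ = refl
  ... | false | false | ≢ = ⊥-elim (≢ refl)

  S∩A⊆A′ : ∀ u → S u ≡ true → A u ≡ true → inA' u ≡ true
  S∩A⊆A′ u Su Au with inA' u in A′u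
  ... | true = refl
  ... | false = ⊥-elim (false≢true (trans (sym (cong not Au)) (proj₁ B′-top u Su)))

  S∩B⊆B′ : ∀ u → S u ≡ true → B u ≡ true → inB' u ≡ true
  S∩B⊆B′ u Su Bu with inA' u in A′u
  ... | true = ⊥-elim (false≢true (trans (sym (cong not (proj₁ A′-top u A′u))) Bu))
  ... | false = Su

  deg-σ'-A′ : ∀ u (Su : S u ≡ true) → inA' u ≡ true → deg G (σ' u Su) ≤ Δ-A′
  deg-σ'-A′ u Su A′u = subst (λ p → deg G (σ' u p) ≤ Δ-A′) (Bool-irrelevant _ Su)
    (maxOver-≥ inA' (λ v p → deg G (σ' v (∨-inˡ (inA' v) (inB' v) p))) u A′u)

  deg-σ'-B′ : ∀ u (Su : S u ≡ true) → inB' u ≡ true → deg G (σ' u Su) ≤ Δ-B′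
  deg-σ'-B′ u Su B′u = subst (λ p → deg G (σ' u p) ≤ Δ-B′) (Bool-irrelevant _ Su)
    (maxOver-≥ inB' (λ v p → deg G (σ' v (∨-inʳ (inA' v) (inB' v) p))) u B′u)

  Agrees : (Fin n → Bool) → (Fin n → Fin N) → Set
  Agrees D τ = Covers S D × (∀ u (Su : S u ≡ true) → τ u ≡ σ' u Su)

  Partial : (Fin n → Bool) → (Fin n → Fin N) → Set
  Partial D τ = Embeds F G D τ × Agrees D τ

  extend-partial : ∀ {D τ} v (H : Fin N → Bool) → Partial D τ → D v ≡ false →
    count D + load F G D τ v + count H < N →
    Σ (Fin N) λ x → H x ≡ false × Partial (insert D v) (update τ v x)
  extend-partial {D} {τ} v H (embeds , S⊆D , agrees) Dv room with extension F G v H embeds room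
  ... | x , Hx , embeds′ = x , Hx , embeds′ , (λ u Su → insert-⊇ D v u (S⊆D u Su)) , agrees′
    where
    agrees′ : ∀ u (Su : S u ≡ true) → update τ v x u ≡ σ' u Su
    agrees′ u Su = trans (update-≢ τ v x u (λ { refl → false≢true (trans (sym Dv) (S⊆D u Su)) })) (agrees u Su)

  -- Vertices outside S get a placeholder image, overwritten later; n ≤ N as soon as S misses a vertex.
  initial-image : ∀ u b → S u ≡ b → Fin N
  initial-image u true Su = σ' u Su
  initial-image u false Su = inject≤ u (n≤N u Su)

  τ₀ : Fin n → Fin N
  τ₀ u = initial-image u (S u) refl

  τ₀-agrees : ∀ u (Su : S u ≡ true) → τ₀ u ≡ σ' u Su
  τ₀-agrees u Su = agrees-at (S u) refl
    where
    agrees-at : ∀ b (q : S u ≡ b) → initial-image u b q ≡ σ' u Su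
    agrees-at true q = cong (σ' u) (Bool-irrelevant q Su)
    agrees-at false q = ⊥-elim (false≢true (trans (sym q) Su))

  Phase₁ : (Fin n → Bool) → (Fin n → Fin N) → Set
  Phase₁ D τ = Partial D τ × (∀ u → D u ≡ true → S u ≡ true ⊎ (B u ≡ true × high (τ u) ≡ false))

  phase₁-initial : Phase₁ S τ₀
  phase₁-initial = (IsPartialEmbedding-cong F G τ₀ τ₀-agrees σ'-embeds , (λ _ Su → Su) , τ₀-agrees) , λ _ Su → inj₁ Su

  -- The only embedded neighbours of a vertex of B are in A′, with images of degree at most Δ-A′.
  phase₁-step : ∀ D τ v → Phase₁ D τ → D v ≡ false → B v ≡ true → Σ (Fin n → Fin N) (Phase₁ (insert D v))
  phase₁-step D τ v (partial , placed) Dv Bv =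
    let x , not-high , partial′ = extend-partial v high partial Dv room in update τ v x , partial′ , placed′ x not-high
    where
    Sv : S v ≡ false
    Sv = Covers⇒≡false S D (proj₁ (proj₂ partial)) v Dv
    neighbour-deg : ∀ u → D u ≡ true → adj F v u ≡ true → 1 * deg G (τ u) ≤ Δ-A′
    neighbour-deg u Du vu∈F with placed u Du | side-of-neighbour u v vu∈F
    ... | inj₁ Su | Au rewrite *-identityˡ (deg G (τ u)) | proj₂ (proj₂ partial) u Su =
          deg-σ'-A′ u Su (S∩A⊆A′ u Su (trans Au Bv))
    ... | inj₂ (Bu , _) | Au = ⊥-elim (false≢true (trans (sym (cong not (trans Au Bv))) Bu))
    room : count D + load F G D τ v + count high < N
    room = room-phase₁ ℓ (count D) (load F G D τ v) (count high) m Δ-A′ n N (count<n D v Dv)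
      (subst (λ t → suc ℓ * t ≤ m * Δ-A′) (*-identityˡ (load F G D τ v))
        (scaled-bound (suc ℓ) 1 (load F G D τ v) (deg F v) Δ-A′ m
          (load-bound F G D τ v 1 Δ-A′ neighbour-deg) (deg-B-bound v Bv (∨≡false⇒ʳ (inA' v) (inB' v) Sv))))
      few-high (cond₁-at v Bv Sv)
    placed′ : ∀ x → high x ≡ false → ∀ u → insert D v u ≡ true → S u ≡ true ⊎ (B u ≡ true × high (update τ v x u) ≡ false)
    placed′ x not-high u u∈ with update-view D τ v x u u∈
    ... | inj₁ (refl , τ′u≡x) rewrite τ′u≡x = inj₂ (Bv , not-high)
    ... | inj₂ (Du , τ′u≡τu) rewrite τ′u≡τu = placed u Du

  Phase₂ : (Fin n → Bool) → (Fin n → Fin N) → Set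
  Phase₂ D τ = Partial D τ × (∀ u → D u ≡ true → B u ≡ true → N * deg G (τ u) ≤ K)

  phase₁⇒phase₂ : ∀ {D τ} → Phase₁ D τ → Phase₂ D τ
  phase₁⇒phase₂ {D} {τ} (partial , placed) = partial , bounded
    where
    bounded : ∀ u → D u ≡ true → B u ≡ true → N * deg G (τ u) ≤ K
    bounded u Du Bu with placed u Du
    ... | inj₁ Su rewrite proj₂ (proj₂ partial) u Su =
          ≤-trans (*-monoʳ-≤ N (deg-σ'-B′ u Su (S∩B⊆B′ u Su Bu))) (m≤m⊔n (N * Δ-B′) (4 * e))
    ... | inj₂ (_ , not-high) =
          ≤-trans (≮⇒≥ (isYes≡false⇒¬ (4 * e ℕ.<? N * deg G (τ u)) not-high)) (m≤n⊔m (N * Δ-B′) (4 * e))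

  -- Every embedded neighbour of a vertex of A lies in B, so its image has N * deg ≤ K.
  phase₂-step : ∀ D τ v → Phase₂ D τ → D v ≡ false → A v ≡ true → Σ (Fin n → Fin N) (Phase₂ (insert D v))
  phase₂-step D τ v (partial , bounded) Dv Av =
    let x , _ , partial′ = extend-partial v (λ _ → false) partial Dv room in update τ v x , partial′ , bounded′ x
    where
    Sv : S v ≡ false
    Sv = Covers⇒≡false S D (proj₁ (proj₂ partial)) v Dv
    neighbour-deg : ∀ u → D u ≡ true → adj F v u ≡ true → N * deg G (τ u) ≤ K
    neighbour-deg u Du vu∈F = bounded u Du (trans (cong not (side-of-neighbour u v vu∈F)) (cong not (cong not Av)))
    cond : m * K + suc k * n * N ≤ suc k * N * N
    cond = let small-B′ , small-avg = cond₂-at v Av Sv in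
      *-⊔-+-lub m (N * Δ-B′) (4 * e) (suc k * n * N) (suc k * N * N)
        (scale-condition m Δ-B′ (suc k * n) (suc k * N) N small-B′) small-avg
    room : count D + load F G D τ v + count {N} (λ _ → false) < N
    room = subst (_< N) (sym (trans (cong (count D + load F G D τ v +_) (sumFin-zero N)) (+-identityʳ _)))
      (room-phase₂ k (count D) (load F G D τ v) m K n N (count<n D v Dv) (n≤N v Sv)
        (scaled-bound (suc k) N (load F G D τ v) (deg F v) K m
          (load-bound F G D τ v N K neighbour-deg) (deg-A-bound v Av (∨≡false⇒ˡ (inA' v) (inB' v) Sv)))
        cond)
    bounded′ : ∀ x u → insert D v u ≡ true → B u ≡ true → N * deg G (update τ v x u) ≤ K
    bounded′ x u u∈ Bu with update-view D τ v x u u∈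
    ... | inj₁ (refl , _) = ⊥-elim (false≢true (trans (sym (cong not Av)) Bu))
    ... | inj₂ (Du , τ′u≡τu) rewrite τ′u≡τu = bounded u Du Bu

lemma2p4 : (n : ℕ) (F : Graph n) (side : Fin n → Bool) → IsBipartition F side →
  (k ℓ : ℕ) (inA' inB' : Fin n → Bool) →
  IsTopDeg F side inA' k →
  IsTopDeg F (λ v → not (side v)) inB' ℓ →
  (N : ℕ) (G : Graph N) →
  (σ' : (v : Fin n) → (inA' v ∨ inB' v) ≡ true → Fin N) →
  IsPartialEmbedding F G (λ v → inA' v ∨ inB' v) σ' →
  (Covers (λ v → not (side v)) inB' ⊎
    (2 * edges F * maxOver inA' (λ v p → deg G (σ' v (∨-inˡ (inA' v) (inB' v) p)))
      + suc ℓ * (2 * n) ≤ suc ℓ * N)) →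
  (Covers side inA' ⊎
    ((edges F * maxOver inB' (λ v p → deg G (σ' v (∨-inʳ (inA' v) (inB' v) p)))
        + suc k * n ≤ suc k * N) ×
     (edges F * (4 * edges G) + suc k * n * N ≤ suc k * N * N))) →
  Σ (Fin n → Fin N) (λ σ → IsEmbedding F G σ ×
    (∀ v (p : (inA' v ∨ inB' v) ≡ true) → σ v ≡ σ' v p))
lemma2p4 n F side bip k ℓ inA' inB' A′-top B′-top N G σ' σ'-embeds cond₁ cond₂ =
  let open TwoPhaseEmbedding F G side bip k ℓ inA' inB' A′-top B′-top σ' σ'-embeds cond₁ cond₂
      D₁ , τ₁ , phase₁-done , _ , B⊆D₁ = Greedy.grow-all Phase₁ B phase₁-step S τ₀ phase₁-initial
      D₂ , τ₂ , ((embeds , _ , agrees) , _) , D₁⊆D₂ , A⊆D₂ =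
        Greedy.grow-all Phase₂ A phase₂-step D₁ τ₁ (phase₁⇒phase₂ phase₁-done)
  in τ₂ , Embeds-total F G (covers-both-sides side D₁ D₂ B⊆D₁ D₁⊆D₂ A⊆D₂) embeds , agrees
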